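{- Let $\mathcal{A}$ be an almost disjoint family of subsets of $\mathbb{N}$ with $|\mathcal{A}|=2^{\aleph_0}$. Let $r\in\mathbb{N}$, let $u_0,\ldots,u_r\in\mathbb{N}^\mathbb{N}$, and let $N$ be an infinite subset of $\mathbb{N}$ such that $u_{r-1}\cdots u_0$ is almost injective on $N$ and, for every $j\in\{0,\ldots,r-1\}$, the set $u_j\cdots u_0(N)$ is almost contained in some $A(j)\in\mathcal{A}$. If $B(0),\ldots,B(r-1)\in\mathcal{A}$ and $g=u_r s_{B(r-1)} u_{r-1}\cdots s_{B(0)} u_0$, then $g|_N$ is almost equal to $u_r\cdots u_0|_N$ or to a constant function on $N$.
   Context: $\mathbb{N}=\{0,1,2,\ldots\}$; $\mathbb{N}^\mathbb{N}$ is the set of all maps $\mathbb{N}\to\mathbb{N}$, with products denoting composition, $(fg)(n)=f(g(n))$ (the empty product being the identity). A family $\mathcal{A}$ of subsets of $\mathbb{N}$ is almost disjoint if $A\cap B$ is finite for all distinct $A,B\in\mathcal{A}$. For $B\subseteq\mathbb{N}$, $s_B(n)=n$ if $n\in B$ and $s_B(n)=0$ otherwise. For an infinite set $N$: a map on $N$ is almost injective if it is injective on a cofinite subset of $N$; a set $Y$ is almost contained in $Z$ if all but finitely many elements of $Y$ lie in $Z$; two maps on $N$ are almost equal if they agree on a cofinite subset of $N$. -}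

module Defs where

open import Data.Nat using (ℕ; zero; suc; _≤_)
open import Data.Bool using (Bool; true; false; if_then_else_)
open import Data.Product using (Σ; ∃; _×_; _,_)
open import Relation.Nullary using (¬_)
open import Relation.Binary.PropositionalEquality using (_≡_)
open import Function using (id; _∘_)

SubsetN : Set
SubsetN = ℕ → Bool

_∈ₛ_ : ℕ → SubsetN → Set
n ∈ₛ A = A n ≡ true

_≐_ : SubsetN → SubsetN → Set
A ≐ B = ∀ n → A n ≡ B n

Family : Set₁
Family = SubsetN → Set

FiniteP : (ℕ → Set) → Set
FiniteP P = ∃ λ m → ∀ n → P n → ¬ (m ≤ n)

AlmostDisjoint : Family → Set
AlmostDisjoint 𝒜 = ∀ A B → 𝒜 A → 𝒜 B → ¬ (A ≐ B) →
  FiniteP (λ n → n ∈ₛ A × n ∈ₛ B)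

-- |𝒜| = 2^ℵ₀ : a bijection between 𝒜 (up to extensional equality
-- of subsets) and the Cantor space ℕ → Bool.
HasSizeContinuum : Family → Set
HasSizeContinuum 𝒜 =
  Σ ((ℕ → Bool) → SubsetN) λ f →
      (∀ x → 𝒜 (f x))
    × (∀ x y → f x ≐ f y → ∀ n → x n ≡ y n)
    × (∀ A → 𝒜 A → ∃ λ x → f x ≐ A)

s : SubsetN → ℕ → ℕ
s B n = if B n then n else 0

Infinite : (ℕ → Set) → Set
Infinite N = ∀ m → ∃ λ n → m ≤ n × N n

AlmostInjectiveOn : (ℕ → Set) → (ℕ → ℕ) → Set
AlmostInjectiveOn N f = ∃ λ m → ∀ x y → N x → N y → m ≤ x → m ≤ y →
  f x ≡ f y → x ≡ y

ImageAlmostContainedIn : (ℕ → Set) → (ℕ → ℕ) → SubsetN → Set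
ImageAlmostContainedIn N f A =
  FiniteP (λ y → (∃ λ x → N x × f x ≡ y) × ¬ (y ∈ₛ A))

AlmostEqualOn : (ℕ → Set) → (ℕ → ℕ) → (ℕ → ℕ) → Set
AlmostEqualOn N f h = FiniteP (λ x → N x × ¬ (f x ≡ h x))

-- prod u k = u_{k-1} ⋯ u_0  (empty product = identity).
prod : (ℕ → ℕ → ℕ) → ℕ → ℕ → ℕ
prod u zero = id
prod u (suc k) = u k ∘ prod u k

sProd : (ℕ → ℕ → ℕ) → (ℕ → SubsetN) → ℕ → ℕ → ℕ
sProd u B zero = id
sProd u B (suc k) = s (B k) ∘ u k ∘ sProd u B k

gMap : (ℕ → ℕ → ℕ) → (ℕ → SubsetN) → ℕ → ℕ → ℕ
gMap u B r = u r ∘ sProd u B r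

module Submission where

-- Write  g_k = s_{B(k-1)} u_{k-1} ⋯ s_{B(0)} u_0  and
-- f_k = u_{k-1} ⋯ u_0.  We show by induction on k ≤ r that on N the map
-- g_k is eventually (i.e. at all large enough points of N) equal to f_k
-- or eventually constant; applying u_r then gives the theorem.
--   A constant stays constant under  s_{B(k)} u_k.  Otherwise g_{k+1}
-- eventually equals  s_{B(k)} f_{k+1}.  Since f_{k+1} is a prefix of the
-- almost injective f_r, every value is attained only finitely often, so
-- f_{k+1} tends to infinity along N (this uses excluded middle); as its
-- image is almost contained in A(k), its values eventually lie in A(k).
-- If A(k) = B(k) the selector s_{B(k)} then acts as the identity; if not,
-- A(k) ∩ B(k) is finite, so the large values f_{k+1} takes lie outside
-- B(k) and s_{B(k)} sends them to 0.
--   The file develops, in order: the "eventually on N" modality, the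
-- divergence of almost injective maps, prefixes of almost injective
-- composites, the selector dichotomy, and the induction itself.

open import Defs
open import Level using (0ℓ)
open import Axiom.ExcludedMiddle using (ExcludedMiddle)
open import Data.Nat using (ℕ; zero; suc; _<_; _≤_; _⊔_; _≤′_; ≤′-refl; ≤′-step; z≤n)
open import Data.Nat.Properties
  using (≤-trans; m≤m⊔n; m≤n⊔m; ≤∧≢⇒<; <-irrefl; ≤⇒≤′; n≤1+n; ≤-refl)
open import Data.Bool using (true; _≟_)
open import Data.Bool.Properties using (¬-not)
open import Data.Product using (∃; _×_; _,_)
open import Data.Sum using (_⊎_; inj₁; inj₂)
open import Function using (_∘_)
open import Relation.Nullary using (¬_; yes; no)
open import Relation.Nullary.Decidable using (decidable-stable)
open import Relation.Binary.PropositionalEquality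
  using (_≡_; _≢_; refl; sym; trans; cong)

Eventually : (ℕ → Set) → (ℕ → Set) → Set
Eventually N P = ∃ λ b → ∀ x → N x → b ≤ x → P x

module _ {N : ℕ → Set} where

  eventually-mono : ∀ {P Q : ℕ → Set} → (∀ x → P x → Q x) →
                    Eventually N P → Eventually N Q
  eventually-mono P⇒Q (b , h) = b , λ x nx b≤x → P⇒Q x (h x nx b≤x)

  eventually-both : ∀ {P Q : ℕ → Set} → Eventually N P → Eventually N Q →
                    Eventually N (λ x → P x × Q x)
  eventually-both (b , p) (c , q) = b ⊔ c , λ x nx bc≤x →
    p x nx (≤-trans (m≤m⊔n b c) bc≤x) , q x nx (≤-trans (m≤n⊔m b c) bc≤x)

  eventually-trans : ∀ {f g h : ℕ → ℕ} →
                     Eventually N (λ x → f x ≡ g x) →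
                     Eventually N (λ x → g x ≡ h x) →
                     Eventually N (λ x → f x ≡ h x)
  eventually-trans p q = eventually-mono (λ _ (e , e′) → trans e e′) (eventually-both p q)

  eventually⇒almostEqual : ∀ {f h : ℕ → ℕ} →
                           Eventually N (λ x → f x ≡ h x) → AlmostEqualOn N f h
  eventually⇒almostEqual (b , h) = b , λ x (nx , f≢h) b≤x → f≢h (h x nx b≤x)

  Diverges : (ℕ → ℕ) → Set
  Diverges f = ∀ m → Eventually N (λ x → m ≤ f x)

  -- An almost injective map attains each value at most once beyond its
  -- injectivity bound, hence eventually avoids it.
  eventually-avoids : ExcludedMiddle 0ℓ → ∀ {f} → AlmostInjectiveOn N f →
                      ∀ m → Eventually N (λ x → f x ≢ m)
  eventually-avoids em {f} (M , inj) m with em {∃ λ x₀ → N x₀ × M ≤ x₀ × f x₀ ≡ m}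
  ... | yes (x₀ , nx₀ , M≤x₀ , fx₀≡m) = suc x₀ ⊔ M , λ x nx x₀M≤x fx≡m →
    let x₀<x = ≤-trans (m≤m⊔n (suc x₀) M) x₀M≤x
        M≤x  = ≤-trans (m≤n⊔m (suc x₀) M) x₀M≤x
    in <-irrefl (inj x₀ x nx₀ nx M≤x₀ M≤x (trans fx₀≡m (sym fx≡m))) x₀<x
  ... | no none = M , λ x nx M≤x fx≡m → none (x , nx , M≤x , fx≡m)

  almostInjective⇒diverges : ExcludedMiddle 0ℓ → ∀ {f} → AlmostInjectiveOn N f →
                             Diverges f
  almostInjective⇒diverges em f-inj zero = 0 , λ _ _ _ → z≤n
  almostInjective⇒diverges em f-inj (suc m) =
    eventually-mono (λ x (m≤fx , fx≢m) → ≤∧≢⇒< m≤fx (fx≢m ∘ sym))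
      (eventually-both (almostInjective⇒diverges em f-inj m)
                       (eventually-avoids em f-inj m))

  -- A divergent map whose image is almost contained in A eventually takes
  -- its values in A: the finitely many exceptional values are left behind.
  diverges⇒eventually-in : ∀ {f A} → Diverges f → ImageAlmostContainedIn N f A →
                           Eventually N (λ x → f x ∈ₛ A)
  diverges⇒eventually-in {f} {A} f-div (m , outside-bounded) with f-div m
  ... | b , m≤f = b , λ x nx b≤x →
    decidable-stable (A (f x) ≟ true)
      (λ fx∉A → outside-bounded (f x) ((x , nx , refl) , fx∉A) (m≤f x nx b≤x))

s-inside : ∀ B {n} → n ∈ₛ B → s B n ≡ n
s-inside B n∈B rewrite n∈B = refl

s-outside : ∀ B {n} → ¬ n ∈ₛ B → s B n ≡ 0
s-outside B n∉B rewrite ¬-not n∉B = refl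

-- Selector dichotomy: if f diverges along N with values eventually in a
-- member A of an almost disjoint family, then for any member B, s_B ∘ f is
-- eventually f (when A = B) or eventually 0 (when A ∩ B is finite).
selector-dichotomy : ExcludedMiddle 0ℓ → ∀ {𝒜 A B N f} → AlmostDisjoint 𝒜 →
  𝒜 A → 𝒜 B → Diverges {N} f → Eventually N (λ x → f x ∈ₛ A) →
  Eventually N (λ x → s B (f x) ≡ f x) ⊎ Eventually N (λ x → s B (f x) ≡ 0)
selector-dichotomy em {A = A} {B = B} {f = f} disjoint 𝒜A 𝒜B f-div f∈A with em {A ≐ B}
... | yes A≐B = inj₁ (eventually-mono
        (λ x fx∈A → s-inside B (trans (sym (A≐B (f x))) fx∈A)) f∈A)
... | no A≢B with disjoint A B 𝒜A 𝒜B A≢B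
...   | m , common-bounded = inj₂ (eventually-mono
        (λ x (fx∈A , m≤fx) → s-outside B (λ fx∈B → common-bounded (f x) (fx∈A , fx∈B) m≤fx))
        (eventually-both f∈A (f-div m)))

module _ (u : ℕ → ℕ → ℕ) where

  -- f_m = u_{m-1} ⋯ u_n f_n, so equal values of f_n stay equal under f_m ...
  prod-extends : ∀ {n m x y} → n ≤′ m → prod u n x ≡ prod u n y → prod u m x ≡ prod u m y
  prod-extends ≤′-refl        e = e
  prod-extends (≤′-step n≤′m) e = cong (u _) (prod-extends n≤′m e)

  almostInjective-prefix : ∀ {N n m} → n ≤ m →
    AlmostInjectiveOn N (prod u m) → AlmostInjectiveOn N (prod u n)
  almostInjective-prefix n≤m (M , inj) = M , λ x y nx ny M≤x M≤y e →
    inj x y nx ny M≤x M≤y (prod-extends (≤⇒≤′ n≤m) e)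

EqualOrConstant : (ℕ → Set) → (ℕ → ℕ) → (ℕ → ℕ) → Set
EqualOrConstant N f h =
  Eventually N (λ x → f x ≡ h x) ⊎ (∃ λ c → Eventually N (λ x → f x ≡ c))

module _ {N : ℕ → Set} where

  equalOrConstant-∘ : ∀ v {f h} → EqualOrConstant N f h → EqualOrConstant N (v ∘ f) (v ∘ h)
  equalOrConstant-∘ v (inj₁ f≈h)       = inj₁ (eventually-mono (λ _ → cong v) f≈h)
  equalOrConstant-∘ v (inj₂ (c , f≈c)) = inj₂ (v c , eventually-mono (λ _ → cong v) f≈c)

  equalOrConstant-select : ∀ B {g h} → EqualOrConstant N g h →
    Eventually N (λ x → s B (h x) ≡ h x) ⊎ Eventually N (λ x → s B (h x) ≡ 0) →
    EqualOrConstant N (s B ∘ g) h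
  equalOrConstant-select B (inj₂ (c , g≈c)) _ =
    inj₂ (s B c , eventually-mono (λ _ → cong (s B)) g≈c)
  equalOrConstant-select B (inj₁ g≈h) (inj₁ sh≈h) =
    inj₁ (eventually-trans (eventually-mono (λ _ → cong (s B)) g≈h) sh≈h)
  equalOrConstant-select B (inj₁ g≈h) (inj₂ sh≈0) =
    inj₂ (0 , eventually-trans (eventually-mono (λ _ → cong (s B)) g≈h) sh≈0)

  equalOrConstant⇒almostEqual : ∀ {f h} → EqualOrConstant N f h →
    AlmostEqualOn N f h ⊎ (∃ λ c → AlmostEqualOn N f (λ _ → c))
  equalOrConstant⇒almostEqual (inj₁ f≈h)       = inj₁ (eventually⇒almostEqual f≈h)
  equalOrConstant⇒almostEqual (inj₂ (c , f≈c)) = inj₂ (c , eventually⇒almostEqual f≈c)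

-- Step k → k+1: apply u_k to the invariant, then insert s_{B(k)}, which acts
-- on the divergent map f_{k+1} (values eventually in A(k)) as 1 or as 0.
selected-product : ExcludedMiddle 0ℓ → ∀ {𝒜} → AlmostDisjoint 𝒜 →
  ∀ {r u N} → AlmostInjectiveOn N (prod u r) →
  (A : ℕ → SubsetN) → (∀ j → j < r → 𝒜 (A j)) →
  (∀ j → j < r → ImageAlmostContainedIn N (prod u (suc j)) (A j)) →
  (B : ℕ → SubsetN) → (∀ j → j < r → 𝒜 (B j)) →
  ∀ k → k ≤ r → EqualOrConstant N (sProd u B k) (prod u k)
selected-product em disjoint u-inj A A∈ A-cont B B∈ zero _ = inj₁ (0 , λ _ _ _ → refl)
selected-product em disjoint {u = u} u-inj A A∈ A-cont B B∈ (suc k) k<r =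
  equalOrConstant-select (B k)
    (equalOrConstant-∘ (u k) (selected-product em disjoint u-inj A A∈ A-cont B B∈ k
                                (≤-trans (n≤1+n k) k<r)))
    (selector-dichotomy em disjoint (A∈ k k<r) (B∈ k k<r) f-div
       (diverges⇒eventually-in f-div (A-cont k k<r)))
  where
  f-div : Diverges (prod u (suc k))
  f-div = almostInjective⇒diverges em (almostInjective-prefix u k<r u-inj)

-- Lemma 4.2: apply u_r to the invariant at k = r.
lemma4p2 : ExcludedMiddle 0ℓ →
    (𝒜 : Family) → AlmostDisjoint 𝒜 → HasSizeContinuum 𝒜 →
    (r : ℕ) (u : ℕ → ℕ → ℕ) (N : ℕ → Set) → Infinite N →
    AlmostInjectiveOn N (prod u r) →
    (A : ℕ → SubsetN) → (∀ j → j < r → 𝒜 (A j)) →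
    (∀ j → j < r → ImageAlmostContainedIn N (prod u (suc j)) (A j)) →
    (B : ℕ → SubsetN) → (∀ j → j < r → 𝒜 (B j)) →
    AlmostEqualOn N (gMap u B r) (prod u (suc r))
      ⊎ (∃ λ c → AlmostEqualOn N (gMap u B r) (λ _ → c))
lemma4p2 em 𝒜 disjoint _ r u N _ u-inj A A∈ A-cont B B∈ =
  equalOrConstant⇒almostEqual
    (equalOrConstant-∘ (u r) (selected-product em disjoint u-inj A A∈ A-cont B B∈ r ≤-refl))
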